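{- For every prime $p$ we have $v_4(p)\ge \beta(4;\mathbb{Q}_p)$.
   Context: For a prime $p$, $v_4(p)$ denotes the largest integer $n$ for which there exists a quartic form over $\mathbb{Q}_p$ in $n$ variables whose only zero in $\mathbb{Q}_p^n$ is the trivial one. For a positive integer $r$, $\beta(r;\mathbb{Q}_p)$ denotes the largest integer $n$ for which there exist $r$ quadratic forms over $\mathbb{Q}_p$ in $n$ variables whose only common zero in $\mathbb{Q}_p^n$ is the trivial one. -}

module Defs where

open import Data.Nat using (ℕ; zero; suc; _^_; _≤_)
import Data.Nat as ℕ
open import Data.Integer using (ℤ; +_; _+_; _-_; _*_; 0ℤ)
open import Data.Integer.Divisibility.Signed using (_∣_; ∣m∣n⇒∣m+n; ∣n⇒∣m*n; ∣m⇒∣m*n; ∣-refl)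
open import Data.Integer.Solver using (module +-*-Solver)
open import Data.Fin using (Fin)
open import Data.Product using (Σ; _×_)
open import Relation.Binary.PropositionalEquality using (_≡_; refl; subst; sym)

-- p-adic integers: p-adically Cauchy sequences of integers
-- (x (k+1) ≡ x k mod p^k), two sequences being equal as p-adic
-- integers iff x k ≡ y k mod p^k for every k (see _≈_ below).

record ℤₚ (p : ℕ) : Set where
  constructor mkℤₚ
  field
    seq    : ℕ → ℤ
    cauchy : ∀ k → (+ (p ^ k)) ∣ (seq (suc k) - seq k)
open ℤₚ public

private
  open +-*-Solver

  eq-scale : ∀ c a b → c * a - c * b ≡ c * (a - b)
  eq-scale = solve 3 (λ c a b → c :* a :- c :* b := c :* (a :- b)) refl

  eq-add : ∀ a b c d → (a + c) - (b + d) ≡ (a - b) + (c - d)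
  eq-add = solve 4 (λ a b c d → (a :+ c) :- (b :+ d) := (a :- b) :+ (c :- d)) refl

  eq-mul : ∀ a b c d → a * c - b * d ≡ a * (c - d) + (a - b) * d
  eq-mul = solve 4 (λ a b c d → a :* c :- b :* d := a :* (c :- d) :+ (a :- b) :* d) refl

scaleₚ : ∀ {p} → ℤ → ℤₚ p → ℤₚ p
scaleₚ c x = mkℤₚ (λ k → c * seq x k)
  (λ k → subst (_ ∣_) (sym (eq-scale c (seq x (suc k)) (seq x k))) (∣n⇒∣m*n c (cauchy x k)))

addₚ : ∀ {p} → ℤₚ p → ℤₚ p → ℤₚ p
addₚ x y = mkℤₚ (λ k → seq x k + seq y k)
  (λ k → subst (_ ∣_) (sym (eq-add (seq x (suc k)) (seq x k) (seq y (suc k)) (seq y k)))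
                (∣m∣n⇒∣m+n (cauchy x k) (cauchy y k)))

mulₚ : ∀ {p} → ℤₚ p → ℤₚ p → ℤₚ p
mulₚ x y = mkℤₚ (λ k → seq x k * seq y k)
  (λ k → subst (_ ∣_) (sym (eq-mul (seq x (suc k)) (seq x k) (seq y (suc k)) (seq y k)))
                (∣m∣n⇒∣m+n (∣n⇒∣m*n (seq x (suc k)) (cauchy y k)) (∣m⇒∣m*n (seq y k) (cauchy x k))))

-- p-adic numbers ℚ_p: pairs (a , e) representing a / p^e with a ∈ ℤ_p.

record ℚₚ (p : ℕ) : Set where
  constructor _/p^_
  field
    num : ℤₚ p
    den : ℕ
open ℚₚ public

_≈_ : ∀ {p} → ℚₚ p → ℚₚ p → Set
_≈_ {p} (a /p^ e) (b /p^ f) =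
  ∀ k → (+ (p ^ k)) ∣ (seq a k * + (p ^ f) - seq b k * + (p ^ e))

0ₚ : ∀ {p} → ℚₚ p
0ₚ {p} = mkℤₚ (λ _ → 0ℤ) (λ k → record { quotient = 0ℤ ; equality = refl }) /p^ 0

_+ₚ_ : ∀ {p} → ℚₚ p → ℚₚ p → ℚₚ p
_+ₚ_ {p} (a /p^ e) (b /p^ f) = addₚ (scaleₚ (+ (p ^ f)) a) (scaleₚ (+ (p ^ e)) b) /p^ (e ℕ.+ f)

_*ₚ_ : ∀ {p} → ℚₚ p → ℚₚ p → ℚₚ p
(a /p^ e) *ₚ (b /p^ f) = mulₚ a b /p^ (e ℕ.+ f)

infixl 6 _+ₚ_
infixl 7 _*ₚ_
infix 4 _≈_

Σₚ : ∀ {p n} → (Fin n → ℚₚ p) → ℚₚ p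
Σₚ {n = zero}  f = 0ₚ
Σₚ {n = suc n} f = f Fin.zero +ₚ Σₚ (λ i → f (Fin.suc i))
  where import Data.Fin as Fin

-- A quadratic form  Q(x) = Σ_{i,j} c_{ij} x_i x_j,
-- a quartic form    F(x) = Σ_{i,j,k,l} c_{ijkl} x_i x_j x_k x_l.
-- (Every quadratic/quartic form can be written this way.)

QuadraticForm : ℕ → ℕ → Set
QuadraticForm p n = Fin n → Fin n → ℚₚ p

QuarticForm : ℕ → ℕ → Set
QuarticForm p n = Fin n → Fin n → Fin n → Fin n → ℚₚ p

evalQuadratic : ∀ {p n} → QuadraticForm p n → (Fin n → ℚₚ p) → ℚₚ p
evalQuadratic c x = Σₚ λ i → Σₚ λ j → c i j *ₚ x i *ₚ x j

evalQuartic : ∀ {p n} → QuarticForm p n → (Fin n → ℚₚ p) → ℚₚ p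
evalQuartic c x =
  Σₚ λ i → Σₚ λ j → Σₚ λ k → Σₚ λ l → c i j k l *ₚ x i *ₚ x j *ₚ x k *ₚ x l

IsTrivial : ∀ {p n} → (Fin n → ℚₚ p) → Set
IsTrivial x = ∀ i → x i ≈ 0ₚ

QuarticAnisotropic : ∀ {p n} → QuarticForm p n → Set
QuarticAnisotropic F = ∀ x → evalQuartic F x ≈ 0ₚ → IsTrivial x

QuadraticSystemAnisotropic : ∀ {p n r} → (Fin r → QuadraticForm p n) → Set
QuadraticSystemAnisotropic Q = ∀ x → (∀ j → evalQuadratic (Q j) x ≈ 0ₚ) → IsTrivial x

IsV4 : ℕ → ℕ → Set
IsV4 p n =
  Σ (QuarticForm p n) QuarticAnisotropic ×
  (∀ m → Σ (QuarticForm p m) QuarticAnisotropic → m ≤ n)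

IsBeta : ℕ → ℕ → ℕ → Set
IsBeta r p n =
  Σ (Fin r → QuadraticForm p n) QuadraticSystemAnisotropic ×
  (∀ m → Σ (Fin r → QuadraticForm p m) QuadraticSystemAnisotropic → m ≤ n)

-- Take a binary form N(u,v) = u² + c·uv + d·v² with no nontrivial zero modulo p
-- (u² + uv + v² for p = 2, and u² − ε·v² with ε a quadratic nonresidue for odd p,
-- which exists because squaring identifies s and −s).  Then
-- G(z) = N(z₀,z₁) + p·N(z₂,z₃) is anisotropic over ℚ_p, in the integral form
-- p^{2j} ∣ G(z) ⇒ p^j ∣ zₐ, proved by descent.  If Q₁,…,Q₄ have no common nontrivial
-- zero, the quartic form G(Q₁,…,Q₄) therefore has only the trivial zero.
-- A p-adic number a / p^e is read at level k as the rational number aₖ / p^e; this is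
-- a ring homomorphism on representatives, so F(x) = G(Q(x)) holds exactly at every
-- level, and clearing denominators turns p^k ∣ F(x)ₖ into p^{2j} ∣ G at integers.

module Submission where

open import Algebra.Bundles using (CommutativeSemiring; CommutativeRing)
open import Data.Fin using (Fin)
import Data.Fin as Fin
open import Data.Fin.Patterns using (0F; 1F; 2F; 3F)
open import Data.Integer using (ℤ; +_; 0ℤ)
import Data.Integer as ℤ
import Data.Integer.Properties as ℤ
open import Data.Integer.Divisibility.Signed
  using (_∣_; _∣?_; divides; quotient; ∣-refl; ∣-trans; ∣m∣n⇒∣m+n; ∣m∣n⇒∣m-n; ∣m+n∣m⇒∣n; ∣m+n∣n⇒∣m;
         ∣m⇒∣m*n; ∣n⇒∣m*n; *-cancelˡ-∣; *-cancelʳ-∣)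
open _∣_ using (equality)
open import Data.Integer.Tactic.RingSolver using (solve-∀)
open import Data.Nat using (ℕ; zero; suc; _≤_)
import Data.Nat as ℕ
import Data.Nat.Properties as ℕ
import Data.Nat.DivMod as ℕ
import Data.Nat.Divisibility as ℕ
open import Data.Nat.Primality using (Prime; prime⇒nonZero; prime⇒irreducible)
import Data.Rational.Unnormalised.Properties as ℚᵘ
open import Data.Product using (_×_; _,_; proj₁; proj₂; Σ)
open import Data.Sum using (inj₂)
open import Relation.Nullary using (¬_; yes; no; contradiction)
open import Relation.Nullary.Decidable using (from-no)
open import Relation.Binary.PropositionalEquality
  using (_≡_; refl; sym; trans; cong; cong₂; subst; subst₂; module ≡-Reasoning)

open import Defs renaming (_≈_ to _≈ₚ_)

module Forms {c ℓ} (R : CommutativeSemiring c ℓ) where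
  open CommutativeSemiring R renaming (refl to ≈-refl; sym to ≈-sym; trans to ≈-trans)
  open import Algebra.Properties.Semiring.Sum semiring public
  open import Algebra.Solver.CommutativeMonoid *-commutativeMonoid using (solve; _⊜_)
    renaming (_⊕_ to infixl 7 _·_)
  open import Relation.Binary.Reasoning.Setoid setoid

  ∑∑ : ∀ {n} → (Fin n → Fin n → Carrier) → Carrier
  ∑∑ {n} f = ∑[ i < n ] ∑[ j < n ] f i j

  ∑∑-cong : ∀ {n} {f g : Fin n → Fin n → Carrier} → (∀ i j → f i j ≈ g i j) → ∑∑ f ≈ ∑∑ g
  ∑∑-cong f≈g = sum-cong-≋ λ i → sum-cong-≋ (f≈g i)

  ∑∑-distribˡ : ∀ {n} x (f : Fin n → Fin n → Carrier) → x * ∑∑ f ≈ ∑∑ λ i j → x * f i j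
  ∑∑-distribˡ {n} x f = ≈-trans (*-distribˡ-sum x λ i → ∑[ j < n ] f i j) (sum-cong-≋ λ i → *-distribˡ-sum x (f i))

  ∑∑-distribʳ : ∀ {n} x (f : Fin n → Fin n → Carrier) → ∑∑ f * x ≈ ∑∑ λ i j → f i j * x
  ∑∑-distribʳ {n} x f = ≈-trans (*-distribʳ-sum x λ i → ∑[ j < n ] f i j) (sum-cong-≋ λ i → *-distribʳ-sum x (f i))

  ∑∑-comm : ∀ {m n} (f : Fin m → Fin m → Fin n → Fin n → Carrier) →
            (∑∑ λ a b → ∑∑ λ i j → f a b i j) ≈ (∑∑ λ i j → ∑∑ λ a b → f a b i j)
  ∑∑-comm {m} {n} f = begin
    ∑[ a < m ] ∑[ b < m ] ∑[ i < n ] ∑[ j < n ] f a b i j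
      ≈⟨ sum-cong-≋ (λ a → ∑-comm λ b i → ∑[ j < n ] f a b i j) ⟩
    ∑[ a < m ] ∑[ i < n ] ∑[ b < m ] ∑[ j < n ] f a b i j
      ≈⟨ ∑-comm (λ a i → ∑[ b < m ] ∑[ j < n ] f a b i j) ⟩
    ∑[ i < n ] ∑[ a < m ] ∑[ b < m ] ∑[ j < n ] f a b i j
      ≈⟨ sum-cong-≋ (λ i → sum-cong-≋ λ a → ∑-comm λ b j → f a b i j) ⟩
    ∑[ i < n ] ∑[ a < m ] ∑[ j < n ] ∑[ b < m ] f a b i j
      ≈⟨ sum-cong-≋ (λ i → ∑-comm λ a j → ∑[ b < m ] f a b i j) ⟩
    ∑[ i < n ] ∑[ j < n ] ∑[ a < m ] ∑[ b < m ] f a b i j ∎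

  ∑∑-*-∑∑ : ∀ {m n} (f : Fin m → Fin m → Carrier) (g : Fin n → Fin n → Carrier) →
            ∑∑ f * ∑∑ g ≈ ∑∑ λ i j → ∑∑ λ k l → f i j * g k l
  ∑∑-*-∑∑ f g = ≈-trans (∑∑-distribʳ (∑∑ g) f) (∑∑-cong λ i j → ∑∑-distribˡ (f i j) g)

  quadratic : ∀ {n} → (Fin n → Fin n → Carrier) → (Fin n → Carrier) → Carrier
  quadratic c x = ∑∑ λ i j → c i j * x i * x j

  quartic : ∀ {n} → (Fin n → Fin n → Fin n → Fin n → Carrier) → (Fin n → Carrier) → Carrier
  quartic c x = ∑∑ λ i j → ∑∑ λ k l → c i j k l * x i * x j * x k * x l

  substitute : ∀ {m n} → (Fin m → Fin m → Carrier) → (Fin m → Fin n → Fin n → Carrier) →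
               Fin n → Fin n → Fin n → Fin n → Carrier
  substitute g A i j k l = ∑∑ λ a b → g a b * A a i j * A b k l

  quadratic-cong : ∀ {n} {c c′ : Fin n → Fin n → Carrier} {x y : Fin n → Carrier} →
                   (∀ i j → c i j ≈ c′ i j) → (∀ i → x i ≈ y i) → quadratic c x ≈ quadratic c′ y
  quadratic-cong c≈c′ x≈y = ∑∑-cong λ i j → *-cong (*-cong (c≈c′ i j) (x≈y i)) (x≈y j)

  quartic-cong : ∀ {n} {c c′ : Fin n → Fin n → Fin n → Fin n → Carrier} {x y : Fin n → Carrier} →
                 (∀ i j k l → c i j k l ≈ c′ i j k l) → (∀ i → x i ≈ y i) → quartic c x ≈ quartic c′ y
  quartic-cong c≈c′ x≈y = ∑∑-cong λ i j → ∑∑-cong λ k l →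
    *-cong (*-cong (*-cong (*-cong (c≈c′ i j k l) (x≈y i)) (x≈y j)) (x≈y k)) (x≈y l)

  quadratic-*ʳ : ∀ {n} (c : Fin n → Fin n → Carrier) x t →
                 quadratic c (λ i → x i * t) ≈ quadratic c x * (t * t)
  quadratic-*ʳ c x t = ≈-trans
    (∑∑-cong λ i j → solve 4 (λ a u v s → a · (u · s) · (v · s) ⊜ a · u · v · (s · s)) ≈-refl (c i j) (x i) (x j) t)
    (≈-sym (∑∑-distribʳ (t * t) λ i j → c i j * x i * x j))

  quartic-substitute : ∀ {m n} (g : Fin m → Fin m → Carrier) (A : Fin m → Fin n → Fin n → Carrier) x →
                       quartic (substitute g A) x ≈ quadratic g (λ a → quadratic (A a) x)
  quartic-substitute g A x = ≈-sym (begin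
    (∑∑ λ a b → g a b * Q a * Q b)
      ≈⟨ ∑∑-cong (λ a b → ≈-trans (*-assoc _ _ _) (*-congˡ (∑∑-*-∑∑ (term a) (term b)))) ⟩
    (∑∑ λ a b → g a b * ∑∑ λ i j → ∑∑ λ k l → term a i j * term b k l)
      ≈⟨ ∑∑-cong (λ a b → ≈-trans (∑∑-distribˡ (g a b) λ i j → ∑∑ λ k l → term a i j * term b k l)
                                  (∑∑-cong λ i j → ∑∑-distribˡ (g a b) λ k l → term a i j * term b k l)) ⟩
    (∑∑ λ a b → ∑∑ λ i j → ∑∑ λ k l → g a b * (term a i j * term b k l))
      ≈⟨ ≈-trans (∑∑-comm λ a b i j → ∑∑ λ k l → g a b * (term a i j * term b k l))
               (∑∑-cong λ i j → ∑∑-comm λ a b k l → g a b * (term a i j * term b k l)) ⟩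
    (∑∑ λ i j → ∑∑ λ k l → ∑∑ λ a b → g a b * (term a i j * term b k l))
      ≈⟨ ∑∑-cong (λ i j → ∑∑-cong λ k l → ∑∑-cong λ a b →
                   regroup (g a b) (A a i j) (A b k l) (x i) (x j) (x k) (x l)) ⟩
    (∑∑ λ i j → ∑∑ λ k l → ∑∑ λ a b → g a b * A a i j * A b k l * (x i * x j * x k * x l))
      ≈⟨ ∑∑-cong (λ i j → ∑∑-cong λ k l →
           ≈-trans (≈-sym (∑∑-distribʳ (x i * x j * x k * x l) λ a b → g a b * A a i j * A b k l))
                 (≈-sym (*-assoc⁴ (substitute g A i j k l) (x i) (x j) (x k) (x l)))) ⟩
    quartic (substitute g A) x ∎)
    where
    Q : _ → Carrier
    Q a = quadratic (A a) x
    term : _ → _ → _ → Carrier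
    term a i j = A a i j * x i * x j
    regroup : ∀ γ α β u v w z → γ * (α * u * v * (β * w * z)) ≈ γ * α * β * (u * v * w * z)
    regroup = solve 7 (λ γ α β u v w z → γ · (α · u · v · (β · w · z)) ⊜ γ · α · β · (u · v · w · z)) ≈-refl
    *-assoc⁴ : ∀ s u v w z → s * u * v * w * z ≈ s * (u * v * w * z)
    *-assoc⁴ = solve 5 (λ s u v w z → s · u · v · w · z ⊜ s · (u · v · w · z)) ≈-refl

module ℤForms = Forms ℤ.+-*-commutativeSemiring
module ℚForms = Forms (CommutativeRing.commutativeSemiring ℚᵘ.+-*-commutativeRing)

upper-bound : ∀ {n} (f : Fin n → ℕ) → Σ ℕ λ T → ∀ i → f i ≤ T
upper-bound {zero} f = 0 , λ ()
upper-bound {suc n} f with T , f∘suc≤T ← upper-bound (λ i → f (Fin.suc i)) = f 0F ℕ.⊔ T , λ where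
  0F → ℕ.m≤m⊔n (f 0F) T
  (Fin.suc i) → ℕ.m≤n⇒m≤o⊔n (f 0F) (f∘suc≤T i)

module _ {k : ℤ} where
  open Data.Integer using (_+_; _-_; _*_)

  ∣m-n∣n-o⇒∣m-o : ∀ {m n o} → k ∣ m - n → k ∣ n - o → k ∣ m - o
  ∣m-n∣n-o⇒∣m-o {m} {n} {o} k∣m-n k∣n-o = subst (k ∣_) (telescope m n o) (∣m∣n⇒∣m+n k∣m-n k∣n-o)
    where
    telescope : ∀ m n o → (m - n) + (n - o) ≡ m - o
    telescope = solve-∀

  ∣m-n∣m-o⇒∣o-n : ∀ {m n o} → k ∣ m - n → k ∣ m - o → k ∣ o - n
  ∣m-n∣m-o⇒∣o-n {m} {n} {o} k∣m-n k∣m-o = subst (k ∣_) (difference m n o) (∣m∣n⇒∣m-n k∣m-n k∣m-o)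
    where
    difference : ∀ m n o → (m - n) - (m - o) ≡ o - n
    difference = solve-∀

  ∣m∣m-n⇒∣n : ∀ {m n} → k ∣ m → k ∣ m - n → k ∣ n
  ∣m∣m-n⇒∣n {m} {n} k∣m k∣m-n = subst (k ∣_) (difference m n) (∣m∣n⇒∣m-n k∣m k∣m-n)
    where
    difference : ∀ m n → m - (m - n) ≡ n
    difference = solve-∀

  *-congruent : ∀ {a a′ b b′} → k ∣ a - a′ → k ∣ b - b′ → k ∣ a * b - a′ * b′
  *-congruent {a} {a′} {b} {b′} k∣a-a′ k∣b-b′ =
    subst (k ∣_) (expand a a′ b b′) (∣m∣n⇒∣m+n (∣n⇒∣m*n a k∣b-b′) (∣m⇒∣m*n b′ k∣a-a′))
    where
    expand : ∀ a a′ b b′ → a * (b - b′) + (a - a′) * b′ ≡ a * b - a′ * b′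
    expand = solve-∀

module PowersOf (p : ℕ) where
  open Data.Integer using (_+_; _-_; _*_)

  p^_ : ℕ → ℤ
  p^ k = + (p ℕ.^ k)

  p^-+ : ∀ m n → p^ (m ℕ.+ n) ≡ p^ m * p^ n
  p^-+ m n = trans (cong +_ (ℕ.^-distribˡ-+-* p m n)) (ℤ.pos-* (p ℕ.^ m) (p ℕ.^ n))

  p^-suc : ∀ n → p^ suc n ≡ + p * p^ n
  p^-suc n = ℤ.pos-* p (p ℕ.^ n)

  p^-mono-∣ : ∀ {m n} → m ≤ n → p^ m ∣ p^ n
  p^-mono-∣ {m} m≤n with o , refl ← ℕ.m≤n⇒∃[o]m+o≡n m≤n = divides (p^ o) (trans (p^-+ m o) (ℤ.*-comm (p^ m) (p^ o)))

  p^-suc-∣ : ∀ {j w} → p^ j ∣ w → p^ suc j ∣ w * + p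
  p^-suc-∣ {j} {w} (divides q w≡qp^j) =
    divides q (trans (cong (_* + p) w≡qp^j) (trans (reassoc q (p^ j) (+ p)) (cong (q *_) (sym (p^-suc j)))))
    where
    reassoc : ∀ q P p → q * P * p ≡ q * (p * P)
    reassoc = solve-∀

  p^-cancelˡ : .{{_ : ℕ.NonZero p}} → ∀ o m {y} → p^ (o ℕ.+ m) ∣ p^ o * y → p^ m ∣ y
  p^-cancelˡ o m p^o+m∣ = *-cancelˡ-∣ (p^ o) {{ℕ.m^n≢0 p o}} (subst (_∣ _) (p^-+ o m) p^o+m∣)

  p^-cancelʳ : .{{_ : ℕ.NonZero p}} → ∀ m o {y} → p^ (m ℕ.+ o) ∣ y * p^ o → p^ m ∣ y
  p^-cancelʳ m o p^m+o∣ = *-cancelʳ-∣ (p^ o) {{ℕ.m^n≢0 p o}} (subst (_∣ _) (p^-+ m o) p^m+o∣)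

  seq-congruent : (x : ℤₚ p) → ∀ {m k} → m ≤ k → p^ m ∣ seq x k - seq x m
  seq-congruent x {m} {k} m≤k = subst (λ k → p^ m ∣ seq x k - seq x m) (ℕ.m∸n+n≡m m≤k) (telescope (k ℕ.∸ m))
    where
    telescope : ∀ δ → p^ m ∣ seq x (δ ℕ.+ m) - seq x m
    telescope zero = subst (p^ m ∣_) (sym (ℤ.+-inverseʳ (seq x m))) (divides 0ℤ refl)
    telescope (suc δ) = ∣m-n∣n-o⇒∣m-o {m = seq x (suc δ ℕ.+ m)} {n = seq x (δ ℕ.+ m)}
      (∣-trans (p^-mono-∣ (ℕ.m≤n+m m δ)) (cauchy x (δ ℕ.+ m))) (telescope δ)

  seq-∣-stable : (x : ℤₚ p) → ∀ {m k} → m ≤ k → p^ m ∣ seq x k → p^ m ∣ seq x m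
  seq-∣-stable x {m} {k} m≤k p^m∣xₖ = ∣m∣m-n⇒∣n {m = seq x k} p^m∣xₖ (seq-congruent x m≤k)

  private
    numerator-of-difference : ∀ u X → u * + 1 - 0ℤ * X ≡ u
    numerator-of-difference = solve-∀

  ≈0ₚ⇒p^∣num : ∀ {z : ℚₚ p} → z ≈ₚ 0ₚ → ∀ k → p^ k ∣ seq (num z) k
  ≈0ₚ⇒p^∣num {a /p^ e} z≈0 k = subst (p^ k ∣_) (numerator-of-difference (seq a k) (p^ e)) (z≈0 k)

  p^∣num⇒≈0ₚ : ∀ {z : ℚₚ p} → (∀ k → p^ k ∣ seq (num z) k) → z ≈ₚ 0ₚ
  p^∣num⇒≈0ₚ {a /p^ e} p^∣num k = subst (p^ k ∣_) (sym (numerator-of-difference (seq a k) (p^ e))) (p^∣num k)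

constₚ : ∀ {p} → ℤ → ℚₚ p
constₚ c = mkℤₚ (λ _ → c) (λ k → divides 0ℤ (ℤ.+-inverseʳ c)) /p^ 0

substituteₚ : ∀ {p m n} → (Fin m → Fin m → ℤ) → (Fin m → QuadraticForm p n) → QuarticForm p n
substituteₚ g Q i j k l = Σₚ λ a → Σₚ λ b → constₚ (g a b) *ₚ Q a i j *ₚ Q b k l

module Approximation (p : ℕ) .{{_ : ℕ.NonZero p}} where
  open PowersOf p
  open ℚForms
  open import Data.Rational.Unnormalised.Base using (ℚᵘ; mkℚᵘ; _≃_; *≡*; _+_; _*_; 1ℚᵘ; 1/_)
  open import Data.Rational.Unnormalised.Properties
    using (≃-refl; ≃-sym; ≃-trans; ≃-setoid; +-cong; *-cong; *-congˡ; *-congʳ; *-comm; *-distribʳ-+; *-inverseʳ; *-identityʳ)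
  open import Data.Rational.Unnormalised.Solver using (module +-*-Solver)
  open +-*-Solver using (solve; _:=_; _:*_)
  open import Algebra.Properties.Semiring.Exp (CommutativeRing.semiring ℚᵘ.+-*-commutativeRing) using (_^_; ^-homo-*)
  open import Relation.Binary.Reasoning.Setoid ≃-setoid

  ι : ℤ → ℚᵘ
  ι a = mkℚᵘ a 0

  ι-+ : ∀ a b → ι (a ℤ.+ b) ≃ ι a + ι b
  ι-+ a b = *≡* (cong (ℤ._* + 1) (sym (cong₂ ℤ._+_ (ℤ.*-identityʳ a) (ℤ.*-identityʳ b))))

  ι-* : ∀ a b → ι (a ℤ.* b) ≃ ι a * ι b
  ι-* a b = ≃-refl

  ι-injective : ∀ {a b} → ι a ≃ ι b → a ≡ b
  ι-injective {a} {b} (*≡* eq) = trans (sym (ℤ.*-identityʳ a)) (trans eq (ℤ.*-identityʳ b))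

  ι-sum : ∀ {n} (f : Fin n → ℤ) → ι (ℤForms.sum f) ≃ sum (λ i → ι (f i))
  ι-sum {zero} f = ≃-refl
  ι-sum {suc n} f = ≃-trans (ι-+ (f 0F) (ℤForms.sum (λ i → f (Fin.suc i)))) (+-cong ≃-refl (ι-sum (λ i → f (Fin.suc i))))

  ι-quadratic : ∀ {n} (c : Fin n → Fin n → ℤ) x →
                ι (ℤForms.quadratic c x) ≃ quadratic (λ i j → ι (c i j)) (λ i → ι (x i))
  ι-quadratic c x = ≃-trans (ι-sum λ i → ℤForms.sum λ j → c i j ℤ.* x i ℤ.* x j)
                            (sum-cong-≋ λ i → ι-sum λ j → c i j ℤ.* x i ℤ.* x j)

  1/p : ℚᵘ
  1/p = 1/ ι (+ p)

  ι[p^]*1/p^ : ∀ e → ι (p^ e) * 1/p ^ e ≃ 1ℚᵘ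
  ι[p^]*1/p^ zero = ≃-refl
  ι[p^]*1/p^ (suc e) = begin
    ι (p^ suc e) * (1/p * 1/p ^ e)         ≡⟨ cong (λ a → ι a * (1/p * 1/p ^ e)) (p^-suc e) ⟩
    ι (+ p) * ι (p^ e) * (1/p * 1/p ^ e)   ≈⟨ solve 4 (λ P Q r s → P :* Q :* (r :* s) := (P :* r) :* (Q :* s)) ≃-refl
                                                       (ι (+ p)) (ι (p^ e)) 1/p (1/p ^ e) ⟩
    (ι (+ p) * 1/p) * (ι (p^ e) * 1/p ^ e) ≈⟨ *-cong (*-inverseʳ (ι (+ p))) (ι[p^]*1/p^ e) ⟩
    1ℚᵘ * 1ℚᵘ                              ≈⟨ *-identityʳ 1ℚᵘ ⟩
    1ℚᵘ                                    ∎

  approx : ℕ → ℚₚ p → ℚᵘ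
  approx k (a /p^ e) = ι (seq a k) * 1/p ^ e

  approx-rescale : ∀ a e f → ι (p^ f ℤ.* a) * 1/p ^ (e ℕ.+ f) ≃ ι a * 1/p ^ e
  approx-rescale a e f = begin
    ι (p^ f) * ι a * 1/p ^ (e ℕ.+ f)       ≈⟨ *-congˡ {ι (p^ f) * ι a} (^-homo-* 1/p e f) ⟩
    ι (p^ f) * ι a * (1/p ^ e * 1/p ^ f)   ≈⟨ solve 4 (λ P A r s → P :* A :* (r :* s) := A :* r :* (P :* s)) ≃-refl
                                                       (ι (p^ f)) (ι a) (1/p ^ e) (1/p ^ f) ⟩
    ι a * 1/p ^ e * (ι (p^ f) * 1/p ^ f)   ≈⟨ *-congˡ {ι a * 1/p ^ e} (ι[p^]*1/p^ f) ⟩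
    ι a * 1/p ^ e * 1ℚᵘ                    ≈⟨ *-identityʳ (ι a * 1/p ^ e) ⟩
    ι a * 1/p ^ e                          ∎

  approx-+ : ∀ k z w → approx k (z +ₚ w) ≃ approx k z + approx k w
  approx-+ k (a /p^ e) (b /p^ f) = begin
    ι (A′ ℤ.+ B′) * 1/p ^ (e ℕ.+ f)                 ≈⟨ *-congʳ {1/p ^ (e ℕ.+ f)} (ι-+ A′ B′) ⟩
    (ι A′ + ι B′) * 1/p ^ (e ℕ.+ f)                  ≈⟨ *-distribʳ-+ (1/p ^ (e ℕ.+ f)) (ι A′) (ι B′) ⟩
    ι A′ * 1/p ^ (e ℕ.+ f) + ι B′ * 1/p ^ (e ℕ.+ f)
      ≡⟨ cong (λ n → ι A′ * 1/p ^ (e ℕ.+ f) + ι B′ * 1/p ^ n) (ℕ.+-comm e f) ⟩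
    ι A′ * 1/p ^ (e ℕ.+ f) + ι B′ * 1/p ^ (f ℕ.+ e)
      ≈⟨ +-cong (approx-rescale (seq a k) e f) (approx-rescale (seq b k) f e) ⟩
    ι (seq a k) * 1/p ^ e + ι (seq b k) * 1/p ^ f   ∎
    where
    A′ = p^ f ℤ.* seq a k
    B′ = p^ e ℤ.* seq b k

  approx-* : ∀ k z w → approx k (z *ₚ w) ≃ approx k z * approx k w
  approx-* k (a /p^ e) (b /p^ f) = begin
    ι (seq a k) * ι (seq b k) * 1/p ^ (e ℕ.+ f)      ≈⟨ *-congˡ {ι (seq a k) * ι (seq b k)} (^-homo-* 1/p e f) ⟩
    ι (seq a k) * ι (seq b k) * (1/p ^ e * 1/p ^ f)  ≈⟨ solve 4 (λ A B r s → A :* B :* (r :* s) := A :* r :* (B :* s)) ≃-refl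
                                                                 (ι (seq a k)) (ι (seq b k)) (1/p ^ e) (1/p ^ f) ⟩
    ι (seq a k) * 1/p ^ e * (ι (seq b k) * 1/p ^ f)  ∎

  approx-*³ : ∀ k a b c → approx k (a *ₚ b *ₚ c) ≃ approx k a * approx k b * approx k c
  approx-*³ k a b c = ≃-trans (approx-* k (a *ₚ b) c) (*-congʳ {approx k c} (approx-* k a b))

  approx-Σₚ : ∀ k {n} (f : Fin n → ℚₚ p) → approx k (Σₚ f) ≃ sum (λ i → approx k (f i))
  approx-Σₚ k {zero} f = *≡* refl
  approx-Σₚ k {suc n} f = ≃-trans (approx-+ k (f 0F) (Σₚ λ i → f (Fin.suc i)))
                                  (+-cong (≃-refl {approx k (f 0F)}) (approx-Σₚ k λ i → f (Fin.suc i)))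

  approx-Σₚ-≃ : ∀ {k n} {f : Fin n → ℚₚ p} {g} → (∀ i → approx k (f i) ≃ g i) → approx k (Σₚ f) ≃ sum g
  approx-Σₚ-≃ {k} {f = f} f≃g = ≃-trans (approx-Σₚ k f) (sum-cong-≋ f≃g)

  approx-constₚ : ∀ k c → approx k (constₚ c) ≃ ι c
  approx-constₚ k c = *-identityʳ (ι c)

  approx-evalQuadratic : ∀ k {n} (c : QuadraticForm p n) x →
                         approx k (evalQuadratic c x) ≃ quadratic (λ i j → approx k (c i j)) (λ i → approx k (x i))
  approx-evalQuadratic k c x = approx-Σₚ-≃ λ i → approx-Σₚ-≃ λ j → approx-*³ k (c i j) (x i) (x j)

  approx-evalQuartic : ∀ k {n} (c : QuarticForm p n) x →
                       approx k (evalQuartic c x) ≃ quartic (λ i j k′ l → approx k (c i j k′ l)) (λ i → approx k (x i))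
  approx-evalQuartic k c x = approx-Σₚ-≃ λ i → approx-Σₚ-≃ λ j → approx-Σₚ-≃ λ k′ → approx-Σₚ-≃ λ l →
    ≃-trans (approx-*³ k (c i j k′ l *ₚ x i *ₚ x j) (x k′) (x l))
            (*-congʳ {approx k (x l)} (*-congʳ {approx k (x k′)} (approx-*³ k (c i j k′ l) (x i) (x j))))

  approx-substituteₚ : ∀ k {m n} (g : Fin m → Fin m → ℤ) (Q : Fin m → QuadraticForm p n) i j k′ l →
                       approx k (substituteₚ g Q i j k′ l) ≃
                       substitute (λ a b → ι (g a b)) (λ a i j → approx k (Q a i j)) i j k′ l
  approx-substituteₚ k g Q i j k′ l = approx-Σₚ-≃ λ a → approx-Σₚ-≃ λ b →
    ≃-trans (approx-*³ k (constₚ (g a b)) (Q a i j) (Q b k′ l))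
            (*-congʳ {approx k (Q b k′ l)} (*-congʳ {approx k (Q a i j)} (approx-constₚ k (g a b))))

  approx-evalQuartic-substituteₚ : ∀ k {m n} (g : Fin m → Fin m → ℤ) (Q : Fin m → QuadraticForm p n) x →
                                   approx k (evalQuartic (substituteₚ g Q) x) ≃
                                   quadratic (λ a b → ι (g a b)) (λ a → approx k (evalQuadratic (Q a) x))
  approx-evalQuartic-substituteₚ k g Q x = begin
    approx k (evalQuartic (substituteₚ g Q) x)
      ≈⟨ approx-evalQuartic k (substituteₚ g Q) x ⟩
    quartic (λ i j k′ l → approx k (substituteₚ g Q i j k′ l)) X
      ≈⟨ quartic-cong (approx-substituteₚ k g Q) (λ i → ≃-refl) ⟩
    quartic (substitute G (λ a i j → approx k (Q a i j))) X
      ≈⟨ quartic-substitute G (λ a i j → approx k (Q a i j)) X ⟩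
    quadratic G (λ a → quadratic (λ i j → approx k (Q a i j)) X)
      ≈⟨ quadratic-cong {c = G} (λ a b → ≃-refl) (λ a → ≃-sym (approx-evalQuadratic k (Q a) x)) ⟩
    quadratic G (λ a → approx k (evalQuadratic (Q a) x)) ∎
    where
    G = λ a b → ι (g a b)
    X = λ i → approx k (x i)

  ι-common-denominator : ∀ y {e T} → e ≤ T → ι y * 1/p ^ e * ι (p^ T) ≃ ι (y ℤ.* p^ (T ℕ.∸ e))
  ι-common-denominator y {e} {T} e≤T = begin
    ι y * 1/p ^ e * ι (p^ T)                       ≡⟨ cong (λ n → ι y * 1/p ^ e * ι (p^ n)) (sym (ℕ.m∸n+n≡m e≤T)) ⟩
    ι y * 1/p ^ e * ι (p^ (T ℕ.∸ e ℕ.+ e))         ≡⟨ cong (λ a → ι y * 1/p ^ e * ι a) (p^-+ (T ℕ.∸ e) e) ⟩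
    ι y * 1/p ^ e * (ι (p^ (T ℕ.∸ e)) * ι (p^ e))  ≈⟨ solve 4 (λ Y r D P → Y :* r :* (D :* P) := Y :* D :* (P :* r)) ≃-refl
                                                               (ι y) (1/p ^ e) (ι (p^ (T ℕ.∸ e))) (ι (p^ e)) ⟩
    ι y * ι (p^ (T ℕ.∸ e)) * (ι (p^ e) * 1/p ^ e)  ≈⟨ *-congˡ {ι y * ι (p^ (T ℕ.∸ e))} (ι[p^]*1/p^ e) ⟩
    ι y * ι (p^ (T ℕ.∸ e)) * 1ℚᵘ                   ≈⟨ *-identityʳ (ι y * ι (p^ (T ℕ.∸ e))) ⟩
    ι y * ι (p^ (T ℕ.∸ e))                         ≈⟨ ι-* y (p^ (T ℕ.∸ e)) ⟨
    ι (y ℤ.* p^ (T ℕ.∸ e))                         ∎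

  clear-denominators : ∀ {m} (g : Fin m → Fin m → ℤ) n E T (y : Fin m → ℤ) (e : Fin m → ℕ) → (∀ a → e a ≤ T) →
                       ι n * 1/p ^ E ≃ quadratic (λ a b → ι (g a b)) (λ a → ι (y a) * 1/p ^ e a) →
                       n ℤ.* (p^ T ℤ.* p^ T) ≡ p^ E ℤ.* ℤForms.quadratic g (λ a → y a ℤ.* p^ (T ℕ.∸ e a))
  clear-denominators g n E T y e e≤T n/p^E≃G[Y] = ι-injective (begin
    ι (n ℤ.* (p^ T ℤ.* p^ T))                ≈⟨ ι-* n (p^ T ℤ.* p^ T) ⟩
    ι n * (t * t)                            ≈⟨ *-identityʳ (ι n * (t * t)) ⟨
    ι n * (t * t) * 1ℚᵘ                      ≈⟨ *-congˡ {ι n * (t * t)} (ι[p^]*1/p^ E) ⟨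
    ι n * (t * t) * (ι (p^ E) * 1/p ^ E)     ≈⟨ solve 4 (λ N t P r → N :* (t :* t) :* (P :* r) := N :* r :* (t :* t) :* P) ≃-refl
                                                         (ι n) t (ι (p^ E)) (1/p ^ E) ⟩
    ι n * 1/p ^ E * (t * t) * ι (p^ E)       ≈⟨ *-congʳ {ι (p^ E)} (*-congʳ {t * t} n/p^E≃G[Y]) ⟩
    quadratic G Y * (t * t) * ι (p^ E)       ≈⟨ *-congʳ {ι (p^ E)} (quadratic-*ʳ G Y t) ⟨
    quadratic G (λ a → Y a * t) * ι (p^ E)   ≈⟨ *-congʳ {ι (p^ E)} (quadratic-cong {c = G} (λ a b → ≃-refl)
                                                                      (λ a → ι-common-denominator (y a) (e≤T a))) ⟩
    quadratic G (λ a → ι (z a)) * ι (p^ E)   ≈⟨ *-congʳ {ι (p^ E)} (ι-quadratic g z) ⟨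
    ι (ℤForms.quadratic g z) * ι (p^ E)      ≈⟨ *-comm (ι (ℤForms.quadratic g z)) (ι (p^ E)) ⟩
    ι (p^ E) * ι (ℤForms.quadratic g z)      ≈⟨ ι-* (p^ E) (ℤForms.quadratic g z) ⟨
    ι (p^ E ℤ.* ℤForms.quadratic g z)        ∎)
    where
    t = ι (p^ T)
    G = λ a b → ι (g a b)
    Y = λ a → ι (y a) * 1/p ^ e a
    z = λ a → y a ℤ.* p^ (T ℕ.∸ e a)

binary : ℤ → ℤ → ℤ → ℤ → ℤ
binary c d u v = u * u + c * u * v + d * v * v
  where open Data.Integer using (_+_; _*_)

AnisotropicMod : ℕ → ℤ → ℤ → Set
AnisotropicMod p c d = ∀ u v → + p ∣ binary c d u v → + p ∣ u × + p ∣ v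

quaternary : ℤ → ℤ → ℤ → Fin 4 → Fin 4 → ℤ
quaternary c d π 0F 0F = + 1
quaternary c d π 0F 1F = c
quaternary c d π 1F 1F = d
quaternary c d π 2F 2F = π
quaternary c d π 2F 3F = π ℤ.* c
quaternary c d π 3F 3F = π ℤ.* d
quaternary c d π _  _  = 0ℤ

module _ where
  open Data.Integer using (_+_; _-_; _*_)

  binary-*ʳ : ∀ c d u v t → binary c d (u * t) (v * t) ≡ binary c d u v * (t * t)
  binary-*ʳ = scaling
    where
    scaling : ∀ c d u v t → (u * t) * (u * t) + c * (u * t) * (v * t) + d * (v * t) * (v * t)
                            ≡ (u * u + c * u * v + d * v * v) * (t * t)
    scaling = solve-∀

  binary-congruent : ∀ {k} c d {u u′ v v′} → k ∣ u - u′ → k ∣ v - v′ → k ∣ binary c d u v - binary c d u′ v′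
  binary-congruent {k} c d {u} {u′} {v} {v′} k∣u-u′ k∣v-v′ = subst (k ∣_) (regroup c d u u′ v v′)
    (∣m∣n⇒∣m+n (∣m∣n⇒∣m+n (*-congruent {a = u} {u′} {u} {u′} k∣u-u′ k∣u-u′)
                          (∣n⇒∣m*n c (*-congruent {a = u} {u′} {v} {v′} k∣u-u′ k∣v-v′)))
               (∣n⇒∣m*n d (*-congruent {a = v} {v′} {v} {v′} k∣v-v′ k∣v-v′)))
    where
    regroup : ∀ c d u u′ v v′ → (u * u - u′ * u′) + c * (u * v - u′ * v′) + d * (v * v - v′ * v′)
                              ≡ (u * u + c * u * v + d * v * v) - (u′ * u′ + c * u′ * v′ + d * v′ * v′)
    regroup = solve-∀

  quaternary-expand : ∀ c d π (z : Fin 4 → ℤ) →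
                      ℤForms.quadratic (quaternary c d π) z ≡ binary c d (z 0F) (z 1F) + π * binary c d (z 2F) (z 3F)
  quaternary-expand c d π z = expansion c d π (z 0F) (z 1F) (z 2F) (z 3F)
    where
    -- The left-hand side is the double sum written out, so that the solver sees its terms.
    expansion : ∀ c d π a b e f →
      ((+ 1 * a * a + (c * a * b + (0ℤ * a * e + (0ℤ * a * f + 0ℤ)))) +
      ((0ℤ * b * a + (d * b * b + (0ℤ * b * e + (0ℤ * b * f + 0ℤ)))) +
      ((0ℤ * e * a + (0ℤ * e * b + (π * e * e + (π * c * e * f + 0ℤ)))) +
      ((0ℤ * f * a + (0ℤ * f * b + (0ℤ * f * e + (π * d * f * f + 0ℤ)))) + 0ℤ))))
      ≡ (a * a + c * a * b + d * b * b) + π * (e * e + c * e * f + d * f * f)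
    expansion = solve-∀

module Descent (p : ℕ) .{{_ : ℕ.NonZero p}} (c d : ℤ) (anisotropic : AnisotropicMod p c d) where
  open PowersOf p
  open Data.Integer using (_+_; _*_)

  G : (Fin 4 → ℤ) → ℤ
  G = ℤForms.quadratic (quaternary c d (+ p))

  p^2 : p^ 2 ≡ + p * + p
  p^2 = trans (p^-suc 1) (cong (λ n → + p * + n) (ℕ.*-identityʳ p))

  G-scale : ∀ w z → (∀ a → z a ≡ w a * + p) → G z ≡ G w * p^ 2
  G-scale w z z≡wp = trans (ℤForms.quadratic-cong {c = quaternary c d (+ p)} (λ a b → refl) z≡wp)
                           (trans (ℤForms.quadratic-*ʳ (quaternary c d (+ p)) w (+ p)) (cong (G w *_) (sym p^2)))

  p^2∣G⇒p∣ : ∀ z → p^ 2 ∣ G z → ∀ a → + p ∣ z a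
  p^2∣G⇒p∣ z p²∣Gz = λ where
      0F → proj₁ p∣z₀,z₁
      1F → proj₂ p∣z₀,z₁
      2F → proj₁ p∣z₂,z₃
      3F → proj₂ p∣z₂,z₃
    where
    N₁ = binary c d (z 0F) (z 1F)
    N₂ = binary c d (z 2F) (z 3F)
    p²∣N₁+pN₂ : + p * + p ∣ N₁ + + p * N₂
    p²∣N₁+pN₂ = subst₂ _∣_ p^2 (quaternary-expand c d (+ p) z) p²∣Gz
    p∣z₀,z₁ : + p ∣ z 0F × + p ∣ z 1F
    p∣z₀,z₁ = anisotropic (z 0F) (z 1F)
      (∣m+n∣n⇒∣m (∣-trans (divides (+ p) refl) p²∣N₁+pN₂) (∣m⇒∣m*n N₂ ∣-refl))
    p²∣N₁ : + p * + p ∣ N₁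
    p²∣N₁ = divides (binary c d q₀ q₁)
      (trans (cong₂ (binary c d) (equality (proj₁ p∣z₀,z₁)) (equality (proj₂ p∣z₀,z₁))) (binary-*ʳ c d q₀ q₁ (+ p)))
      where
      q₀ = quotient (proj₁ p∣z₀,z₁)
      q₁ = quotient (proj₂ p∣z₀,z₁)
    p∣z₂,z₃ : + p ∣ z 2F × + p ∣ z 3F
    p∣z₂,z₃ = anisotropic (z 2F) (z 3F) (*-cancelˡ-∣ (+ p) (∣m+n∣m⇒∣n p²∣N₁+pN₂ p²∣N₁))

  p^[j+j]∣G⇒p^j∣ : ∀ j z → p^ (j ℕ.+ j) ∣ G z → ∀ a → p^ j ∣ z a
  p^[j+j]∣G⇒p^j∣ zero z _ a = divides (z a) (sym (ℤ.*-identityʳ (z a)))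
  p^[j+j]∣G⇒p^j∣ (suc j) z p^2j+2∣Gz a =
    subst (p^ suc j ∣_) (sym (equality (p∣z a))) (p^-suc-∣ {j} (p^[j+j]∣G⇒p^j∣ j w p^2j∣Gw a))
    where
    p^2j+2∣Gz′ : p^ (j ℕ.+ j ℕ.+ 2) ∣ G z
    p^2j+2∣Gz′ = subst (λ n → p^ n ∣ G z) (trans (cong suc (ℕ.+-suc j j)) (ℕ.+-comm 2 (j ℕ.+ j))) p^2j+2∣Gz
    p∣z : ∀ a → + p ∣ z a
    p∣z = p^2∣G⇒p∣ z (∣-trans (p^-mono-∣ (ℕ.m≤n+m 2 (j ℕ.+ j))) p^2j+2∣Gz′)
    w : Fin 4 → ℤ
    w a = quotient (p∣z a)
    p^2j∣Gw : p^ (j ℕ.+ j) ∣ G w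
    p^2j∣Gw = p^-cancelʳ (j ℕ.+ j) 2 (subst (_ ∣_) (G-scale w z λ a → equality (p∣z a)) p^2j+2∣Gz′)

module Anisotropy (p : ℕ) .{{_ : ℕ.NonZero p}} (c d : ℤ) (anisotropic : AnisotropicMod p c d) where
  open PowersOf p
  open Approximation p using (approx-evalQuartic-substituteₚ; clear-denominators)
  open Descent p c d anisotropic using (G; p^[j+j]∣G⇒p^j∣)
  open Data.Integer using (_*_)

  quadratic-values-vanish : ∀ {n} (Q : Fin 4 → QuadraticForm p n) x →
                            evalQuartic (substituteₚ (quaternary c d (+ p)) Q) x ≈ₚ 0ₚ →
                            ∀ a → evalQuadratic (Q a) x ≈ₚ 0ₚ
  quadratic-values-vanish Q x F[x]≈0 a = p^∣num⇒≈0ₚ {q a} p^m∣qₐ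
    where
    F[x] = evalQuartic (substituteₚ (quaternary c d (+ p)) Q) x
    q : Fin 4 → ℚₚ p
    q b = evalQuadratic (Q b) x
    e : Fin 4 → ℕ
    e b = den (q b)
    T = proj₁ (upper-bound e)

    -- At level k the cancelled p^(den F[x]) still leaves p^(j+j) ∣ G(z), and j exceeds m
    -- by enough to absorb the factor p^(T ∸ e a) of z a.
    p^m∣qₐ : ∀ m → p^ m ∣ seq (num (q a)) m
    p^m∣qₐ m = seq-∣-stable (num (q a)) m≤k (p^-cancelʳ m (T ℕ.∸ e a) (∣-trans (p^-mono-∣ m+[T∸eₐ]≤j) p^j∣zₐ))
      where
      j = m ℕ.+ T
      k = den F[x] ℕ.+ (j ℕ.+ j)
      y : Fin 4 → ℤ
      y b = seq (num (q b)) k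
      z : Fin 4 → ℤ
      z b = y b * p^ (T ℕ.∸ e b)
      cleared : seq (num F[x]) k * (p^ T * p^ T) ≡ p^ (den F[x]) * G z
      cleared = clear-denominators (quaternary c d (+ p)) (seq (num F[x]) k) (den F[x]) T y e (proj₂ (upper-bound e))
                                   (approx-evalQuartic-substituteₚ k (quaternary c d (+ p)) Q x)
      p^j∣zₐ : p^ j ∣ z a
      p^j∣zₐ = p^[j+j]∣G⇒p^j∣ j z (p^-cancelˡ (den F[x]) (j ℕ.+ j)
                 (subst (p^ k ∣_) cleared (∣m⇒∣m*n (p^ T * p^ T) (≈0ₚ⇒p^∣num {F[x]} F[x]≈0 k)))) a
      m+[T∸eₐ]≤j : m ℕ.+ (T ℕ.∸ e a) ≤ j
      m+[T∸eₐ]≤j = ℕ.+-monoʳ-≤ m (ℕ.m∸n≤m T (e a))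
      m≤k : m ≤ k
      m≤k = ℕ.≤-trans (ℕ.m≤m+n m T) (ℕ.≤-trans (ℕ.m≤m+n j j) (ℕ.m≤n+m (j ℕ.+ j) (den F[x])))

  substituteₚ-anisotropic : ∀ {n} (Q : Fin 4 → QuadraticForm p n) → QuadraticSystemAnisotropic Q →
                            QuarticAnisotropic (substituteₚ (quaternary c d (+ p)) Q)
  substituteₚ-anisotropic Q Q-anisotropic x F[x]≈0 = Q-anisotropic x (quadratic-values-vanish Q x F[x]≈0)

module Residues (p : ℕ) .{{_ : ℕ.NonZero p}} where
  open Data.Integer using (_+_; _-_; _*_)
  open import Data.Integer.DivMod using (_%ℕ_; _/ℕ_; n%ℕd<d; a≡a%ℕn+[a/ℕn]*n)

  residue : ℤ → ℕ
  residue t = t %ℕ p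

  residue<p : ∀ t → residue t ℕ.< p
  residue<p t = n%ℕd<d t p

  p∣-residue : ∀ t → + p ∣ t - + residue t
  p∣-residue t = divides (t /ℕ p)
    (trans (cong (_- + residue t) (a≡a%ℕn+[a/ℕn]*n t p)) (cancel (+ residue t) (t /ℕ p * + p)))
    where
    cancel : ∀ r s → (r + s) - r ≡ s
    cancel = solve-∀

  residue≡0⇒p∣ : ∀ t → residue t ≡ 0 → + p ∣ t
  residue≡0⇒p∣ t r≡0 = subst (+ p ∣_) (ℤ.+-identityʳ t) (subst (λ r → + p ∣ t - + r) r≡0 (p∣-residue t))

binary-1-1-mod-2 : ∀ r s → r ℕ.< 2 → s ℕ.< 2 → + 2 ∣ binary (+ 1) (+ 1) (+ r) (+ s) → r ≡ 0 × s ≡ 0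
binary-1-1-mod-2 0 0 _ _ _ = refl , refl
binary-1-1-mod-2 0 1 _ _ 2∣1 = contradiction 2∣1 (from-no (+ 2 ∣? + 1))
binary-1-1-mod-2 1 0 _ _ 2∣1 = contradiction 2∣1 (from-no (+ 2 ∣? + 1))
binary-1-1-mod-2 1 1 _ _ 2∣3 = contradiction 2∣3 (from-no (+ 2 ∣? + 3))
binary-1-1-mod-2 (suc (suc _)) _ (ℕ.s≤s (ℕ.s≤s ())) _ _
binary-1-1-mod-2 _ (suc (suc _)) _ (ℕ.s≤s (ℕ.s≤s ())) _

anisotropic-mod-2 : AnisotropicMod 2 (+ 1) (+ 1)
anisotropic-mod-2 u v 2∣N[u,v] = residue≡0⇒p∣ u (proj₁ r,s≡0) , residue≡0⇒p∣ v (proj₂ r,s≡0)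
  where
  open Residues 2
  2∣N[r,s] : + 2 ∣ binary (+ 1) (+ 1) (+ residue u) (+ residue v)
  2∣N[r,s] = ∣m∣m-n⇒∣n {m = binary (+ 1) (+ 1) u v} 2∣N[u,v]
               (binary-congruent (+ 1) (+ 1) {u = u} {+ residue u} {v} {+ residue v} (p∣-residue u) (p∣-residue v))
  r,s≡0 : residue u ≡ 0 × residue v ≡ 0
  r,s≡0 = binary-1-1-mod-2 (residue u) (residue v) (residue<p u) (residue<p v) 2∣N[r,s]

module PrimeModulus {p : ℕ} (p-prime : Prime p) where
  open Data.Integer using (_+_; _-_; _*_; -_)
  open import Data.Integer.Divisibility.Signed using (∣⇒∣ᵤ; ∣ᵤ⇒∣)
  open import Data.Nat.Primality using (euclidsLemma)
  open import Data.Nat.Coprimality using (prime⇒coprime; coprime-Bézout)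
  import Data.Nat.Coprimality as Coprime
  open import Data.Nat.GCD using (module Bézout)
  open import Data.Sum using (_⊎_; inj₁; map)

  private instance
    p-nonZero : ℕ.NonZero p
    p-nonZero = prime⇒nonZero p-prime

  open Residues p

  euclid : ∀ a b → + p ∣ a * b → + p ∣ a ⊎ + p ∣ b
  euclid a b p∣ab =
    map ∣ᵤ⇒∣ ∣ᵤ⇒∣ (euclidsLemma ℤ.∣ a ∣ ℤ.∣ b ∣ p-prime (subst (p ℕ.∣_) (ℤ.abs-* a b) (∣⇒∣ᵤ p∣ab)))

  p∣-square : ∀ a → + p ∣ a * a → + p ∣ a
  p∣-square a p∣aa with euclid a a p∣aa
  ... | inj₁ p∣a = p∣a
  ... | inj₂ p∣a = p∣a

  inverse-of-Bézout : ∀ r → Bézout.Identity 1 r p → Σ ℤ λ r′ → + p ∣ + r * r′ - + 1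
  inverse-of-Bézout r (Bézout.+- a b 1+bp≡ar) = + a , divides (+ b) (begin
    + r * + a - + 1          ≡⟨ cong (_- + 1) (trans (ℤ.*-comm (+ r) (+ a)) (sym (ℤ.pos-* a r))) ⟩
    + (a ℕ.* r) - + 1        ≡⟨ cong (λ n → + n - + 1) 1+bp≡ar ⟨
    + (1 ℕ.+ b ℕ.* p) - + 1  ≡⟨ cong (_- + 1) (trans (ℤ.pos-+ 1 (b ℕ.* p)) (cong (_+_ (+ 1)) (ℤ.pos-* b p))) ⟩
    + 1 + + b * + p - + 1    ≡⟨ cancel (+ 1) (+ b * + p) ⟩
    + b * + p                ∎)
    where
    open ≡-Reasoning
    cancel : ∀ o s → o + s - o ≡ s
    cancel = solve-∀
  inverse-of-Bézout r (Bézout.-+ a b 1+ar≡bp) = - + a , divides (- + b) (begin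
    + r * - + a - + 1        ≡⟨ negate (+ r) (+ a) ⟩
    - (+ 1 + + a * + r)      ≡⟨ cong -_ (trans (cong (_+_ (+ 1)) (sym (ℤ.pos-* a r))) (sym (ℤ.pos-+ 1 (a ℕ.* r)))) ⟩
    - + (1 ℕ.+ a ℕ.* r)      ≡⟨ cong (λ n → - + n) 1+ar≡bp ⟩
    - + (b ℕ.* p)            ≡⟨ cong -_ (ℤ.pos-* b p) ⟩
    - (+ b * + p)            ≡⟨ ℤ.neg-distribˡ-* (+ b) (+ p) ⟩
    - + b * + p              ∎)
    where
    open ≡-Reasoning
    negate : ∀ r a → r * - a - + 1 ≡ - (+ 1 + a * r)
    negate = solve-∀

  inverse : ∀ y → ¬ (+ p ∣ y) → Σ ℤ λ y′ → + p ∣ y * y′ - + 1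
  inverse y p∤y with residue y | p∣-residue y | residue<p y
  ... | zero | p∣y-0 | _ = contradiction (subst (+ p ∣_) (ℤ.+-identityʳ y) p∣y-0) p∤y
  ... | r@(suc _) | p∣y-r | r<p
    with r′ , p∣rr′-1 ← inverse-of-Bézout r (coprime-Bézout (Coprime.sym (prime⇒coprime p-prime r<p))) =
    r′ , ∣m-n∣n-o⇒∣m-o {m = y * r′}
           (*-congruent {a = y} {+ r} {r′} {r′} p∣y-r (divides 0ℤ (ℤ.+-inverseʳ r′))) p∣rr′-1

  anisotropic-of-nonresidue : ∀ {u} → (∀ t → ¬ (+ p ∣ t * t - + u)) → AnisotropicMod p 0ℤ (- + u)
  anisotropic-of-nonresidue {u} nonresidue x y p∣N with + p ∣? y
  ... | yes p∣y =
    p∣-square x (∣m+n∣n⇒∣m (subst (+ p ∣_) (drop-zero x y (- + u)) p∣N) (∣n⇒∣m*n (- + u * y) p∣y)) , p∣y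
    where
    drop-zero : ∀ x y c → x * x + 0ℤ * x * y + c * y * y ≡ x * x + c * y * y
    drop-zero = solve-∀
  ... | no p∤y with y′ , p∣yy′-1 ← inverse y p∤y = contradiction p∣[xy′]²-u (nonresidue (x * y′))
    where
    p∣[xy′]²-u : + p ∣ x * y′ * (x * y′) - + u
    p∣[xy′]²-u = subst (+ p ∣_) (identity x y y′ (+ u))
      (∣m∣n⇒∣m+n (∣n⇒∣m*n (y′ * y′) p∣N) (∣m⇒∣m*n (y * y′ + + 1) (∣n⇒∣m*n (+ u) p∣yy′-1)))
      where
      identity : ∀ x y y′ U → y′ * y′ * (x * x + 0ℤ * x * y + - U * y * y) + U * (y * y′ - + 1) * (y * y′ + + 1)
                              ≡ x * y′ * (x * y′) - U
      identity = solve-∀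

module OddPrime {p h : ℕ} (p-prime : Prime p) (p≡1+2h : p ≡ suc (h ℕ.+ h)) where
  open Data.Integer using (_+_; _-_; _*_; -_)
  open import Data.Fin using (toℕ; fromℕ<)
  import Data.Fin.Properties as Fin
  open import Data.Integer.Divisibility.Signed using (∣⇒∣ᵤ)
  open import Data.Nat.Primality using (¬prime[1])
  open import Relation.Nullary using (Dec)

  private instance
    p-nonZero : ℕ.NonZero p
    p-nonZero = prime⇒nonZero p-prime

  open Residues p

  SmallSquare : ℤ → Set
  SmallSquare u = Σ (Fin (suc h)) λ s → + p ∣ + toℕ s * + toℕ s - u

  small-square? : ∀ u → Dec (SmallSquare u)
  small-square? u = Fin.any? λ s → + p ∣? + toℕ s * + toℕ s - u

  small-square-representative : ∀ t → Σ (Fin (suc h)) λ s → + p ∣ t * t - + toℕ s * + toℕ s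
  small-square-representative t with residue t ℕ.≤? h
  ... | yes r≤h = fromℕ< (ℕ.s≤s r≤h) , subst (λ s → + p ∣ t * t - + s * + s) (sym (Fin.toℕ-fromℕ< (ℕ.s≤s r≤h)))
                                              (*-congruent {a = t} (p∣-residue t) (p∣-residue t))
  ... | no r≰h = fromℕ< (ℕ.s≤s s≤h) ,
                 subst (λ s → + p ∣ t * t - + s * + s) (sym (Fin.toℕ-fromℕ< (ℕ.s≤s s≤h))) p∣t²-s²
    where
    r = residue t
    s = p ℕ.∸ r
    s≤h : s ≤ h
    s≤h = ℕ.≤-trans (ℕ.∸-monoʳ-≤ p (ℕ.≰⇒> r≰h))
                    (ℕ.≤-reflexive (trans (cong (ℕ._∸ suc h) p≡1+2h) (ℕ.m+n∸m≡n h h)))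
    p≡r+s : + p ≡ + r + + s
    p≡r+s = trans (cong +_ (sym (ℕ.m+[n∸m]≡n (ℕ.<⇒≤ (residue<p t))))) (ℤ.pos-+ r s)
    p∣t+s : + p ∣ t - - + s
    p∣t+s = subst (+ p ∣_) (trans (cong (_+_ (t - + r)) p≡r+s) (regroup t (+ r) (+ s))) (∣m∣n⇒∣m+n (p∣-residue t) ∣-refl)
      where
      regroup : ∀ t r s → t - r + (r + s) ≡ t - - s
      regroup = solve-∀
    p∣t²-s² : + p ∣ t * t - + s * + s
    p∣t²-s² = subst (+ p ∣_) (negated-square t (+ s)) (*-congruent {a = t} {a′ = - + s} {b = t} {b′ = - + s} p∣t+s p∣t+s)
      where
      negated-square : ∀ t s → t * t - (- s) * (- s) ≡ t * t - s * s
      negated-square = solve-∀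

  suc-h<p : suc h ℕ.< p
  suc-h<p = subst (suc h ℕ.<_) (sym p≡1+2h) (ℕ.s≤s (subst (ℕ._≤ h ℕ.+ h) (ℕ.+-comm h 1) (ℕ.+-monoʳ-≤ h 1≤h)))
    where
    1≤h : 1 ≤ h
    1≤h = ℕ.n≢0⇒n>0 λ h≡0 → ¬prime[1] (subst Prime (trans p≡1+2h (cong (λ h → suc (h ℕ.+ h)) h≡0)) p-prime)

  p∤-small-difference : ∀ {i j} → i ℕ.< j → j ℕ.< p → ¬ (+ p ∣ + j - + i)
  p∤-small-difference {i} {j} i<j j<p p∣j-i =
    ℕ.>⇒∤ {{ℕ.>-nonZero (ℕ.m<n⇒0<n∸m i<j)}} (ℕ.≤-<-trans (ℕ.m∸n≤m j i) j<p)
    (subst (p ℕ.∣_) (cong ℤ.∣_∣ (trans (ℤ.m-n≡m⊖n j i) (ℤ.⊖-≥ (ℕ.<⇒≤ i<j)))) (∣⇒∣ᵤ p∣j-i))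

  -- Each residue would have a square root in [0, h], and h + 1 < p such roots cannot
  -- serve p distinct residues.
  not-all-small-squares : ¬ (∀ (u : Fin p) → SmallSquare (+ toℕ u))
  not-all-small-squares small with i , j , i<j , sᵢ≡sⱼ ← Fin.pigeonhole suc-h<p (λ u → proj₁ (small u)) =
    p∤-small-difference i<j (Fin.toℕ<n j) (∣m-n∣m-o⇒∣o-n {m = sᵢ * sᵢ} (proj₂ (small i)) p∣sᵢ²-j)
    where
    sᵢ = + toℕ (proj₁ (small i))
    p∣sᵢ²-j : + p ∣ sᵢ * sᵢ - + toℕ j
    p∣sᵢ²-j = subst (λ s → + p ∣ + toℕ s * + toℕ s - + toℕ j) (sym sᵢ≡sⱼ) (proj₂ (small j))

  nonsquare : Σ (Fin p) λ u → ¬ SmallSquare (+ toℕ u)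
  nonsquare = Fin.¬∀⟶∃¬ p (λ u → SmallSquare (+ toℕ u)) (λ u → small-square? (+ toℕ u)) not-all-small-squares

  nonresidue : Σ ℕ λ u → ∀ t → ¬ (+ p ∣ t * t - + u)
  nonresidue = toℕ (proj₁ nonsquare) , not-square
    where
    not-square : ∀ t → ¬ (+ p ∣ t * t - + toℕ (proj₁ nonsquare))
    not-square t p∣t²-u = proj₂ nonsquare (proj₁ root , ∣m-n∣m-o⇒∣o-n {m = t * t} p∣t²-u (proj₂ root))
      where
      root = small-square-representative t

anisotropic-binary-exists : ∀ {p} → Prime p → Σ ℤ λ c → Σ ℤ λ d → AnisotropicMod p c d
anisotropic-binary-exists {p} p-prime with p ℕ.% 2 | ℕ.m≡m%n+[m/n]*n p 2 | ℕ.m%n<n p 2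
... | 0 | p≡[p/2]*2 | _ with prime⇒irreducible p-prime (ℕ.divides (p ℕ./ 2) p≡[p/2]*2)
...   | inj₂ refl = + 1 , + 1 , anisotropic-mod-2
anisotropic-binary-exists {p} p-prime | 1 | p≡1+[p/2]*2 | _ =
  0ℤ , ℤ.- + proj₁ nonresidue , anisotropic-of-nonresidue (proj₂ nonresidue)
  where
  h = p ℕ./ 2
  open PrimeModulus p-prime using (anisotropic-of-nonresidue)
  open OddPrime {h = h} p-prime (trans p≡1+[p/2]*2 (cong suc (trans (ℕ.*-comm h 2) (cong (h ℕ.+_) (ℕ.+-identityʳ h)))))
anisotropic-binary-exists p-prime | suc (suc _) | _ | ℕ.s≤s (ℕ.s≤s ())

lemma9 : ∀ (p : ℕ) → Prime p → ∀ (v β : ℕ) → IsV4 p v → IsBeta 4 p β → β ≤ v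
lemma9 p p-prime v β (_ , v-maximal) ((Q , Q-anisotropic) , _) =
  v-maximal β (substituteₚ (quaternary c d (+ p)) Q , substituteₚ-anisotropic Q Q-anisotropic)
  where
  c = proj₁ (anisotropic-binary-exists p-prime)
  d = proj₁ (proj₂ (anisotropic-binary-exists p-prime))
  open Anisotropy p {{prime⇒nonZero p-prime}} c d (proj₂ (proj₂ (anisotropic-binary-exists p-prime)))
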